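{- Condition on any realization of the surrogate types at all steps, and run the Two-Way SOCS for Display Ads on the two-way surrogate types. Fix an agent $j$. For any set $S$ of time steps at which two-way surrogate types involving $j$ are realized, the probability that $j$ is selected at none of the steps in $S$ is at most $2^{ -|S|}$. If $S$ is the set of all time steps at which two-way surrogate types involving $j$ are realized, this probability is at most $(1+|S|)2^{ -2|S|}$.
   Context: Two-Way SOCS for Display Ads (stateful): when an item with two-way surrogate type $i\sim\{j,k\}$ (a pair of distinct agents $j,k$) arrives: pick $m\in\{j,k\}$ uniformly at random and mark this step with $m$; if this is the second step marked with $m$, select opposite w.r.t. $m$ to the selection at the first step marked with $m$ (select $m$ iff $m$ was not selected there); otherwise select $j$ or $k$ uniformly at random. All random choices independent. -}

module Defs where

open import Data.Bool using (Bool; true; false; if_then_else_; _∧_; not)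
open import Data.Nat using (ℕ; zero; suc; _≡ᵇ_)
open import Data.Product using (_×_; _,_)
open import Data.List using (List; []; _∷_; length; filterᵇ; concatMap; map)
open import Data.Sum using (_⊎_)
open import Relation.Binary.PropositionalEquality using (_≡_)
open import Data.Vec using (Vec; []; _∷_)
open import Data.Fin using (Fin; zero; suc)
open import Data.Fin.Subset using (Subset; inside; outside)

-- Agents are natural numbers. A two-way surrogate type i ~ {a,b} is an
-- (ordered, for bookkeeping only) pair (a , b) of agents with a ≢ b.
TwoWay : Set
TwoWay = ℕ × ℕ

-- Random choices at one step: (c₁ , c₂).
--   c₁ : which agent is used as the mark m   (true ↦ a, false ↦ b)
--   c₂ : the uniform selection among {a,b}   (true ↦ a, false ↦ b),
--        used only when the step is not the second step marked with m.
Coins : Set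
Coins = Bool × Bool

data Mark : Set where
  unmarked   : Mark
  markedOnce : Bool → Mark   -- exactly one step marked with m; flag = "m was selected there"
  markedMore : Mark

State : Set
State = ℕ → Mark

update : State → ℕ → Mark → State
update st m v x = if x ≡ᵇ m then v else st x

step : State → TwoWay → Coins → ℕ × State
step st (a , b) (c₁ , c₂) with st (if c₁ then a else b)
... | unmarked =
      let m   = if c₁ then a else b
          sel = if c₂ then a else b
      in sel , update st m (markedOnce (sel ≡ᵇ m))
... | markedOnce wasSel =
      let m     = if c₁ then a else b
          other = if c₁ then b else a
          sel   = if wasSel then other else m
      in sel , update st m markedMore
... | markedMore = (if c₂ then a else b) , st

runFrom : ∀ {T} → State → Vec TwoWay T → Vec Coins T → Vec ℕ T
runFrom st [] [] = []
runFrom st (τ ∷ τs) (c ∷ cs) with step st τ c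
... | sel , st' = sel ∷ runFrom st' τs cs

run : ∀ {T} → Vec TwoWay T → Vec Coins T → Vec ℕ T
run = runFrom (λ _ → unmarked)

allCoins : ∀ T → List (Vec Coins T)
allCoins zero = [] ∷ []
allCoins (suc T) =
  concatMap (λ v → map (_∷ v) ((true , true) ∷ (true , false) ∷ (false , true) ∷ (false , false) ∷ []))
            (allCoins T)

noneSelected : ∀ {T} → ℕ → Subset T → Vec ℕ T → Bool
noneSelected j [] [] = true
noneSelected j (inside ∷ S) (x ∷ xs) = not (x ≡ᵇ j) ∧ noneSelected j S xs
noneSelected j (outside ∷ S) (x ∷ xs) = noneSelected j S xs

-- Number of realizations of the random choices in which j is selected at no step of S.
-- The probability of the event is  countNone τ j S / 4 ^ T.
countNone : ∀ {T} → Vec TwoWay T → ℕ → Subset T → ℕ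
countNone {T} τ j S = length (filterᵇ (λ c → noneSelected j S (run τ c)) (allCoins T))

Involves : ℕ → TwoWay → Set
Involves j (a , b) = (j ≡ a) ⊎ (j ≡ b)

module Submission where

-- Probabilities are counted as numbers of coin sequences, so every bound carries the factor 4 ^ T.
-- The key device is deferred decisions: when an agent m is first marked at a step outside S, the
-- selection made there is left unrevealed and is decided by the coin of the second step marked with
-- m; this does not change the count. Afterwards every revealed first-mark flag was recorded at a step
-- of S that avoided j, so the second step marked with that agent selects j if it involves j. Hence at
-- a step of S, whichever of j and its partner is marked, at most one of the two selection coins
-- avoids j: a factor 1/2 per step. If S contains every step involving j, then j's own state changes
-- only on S, and once j has been marked and avoided, marking j again selects j. So j is marked at
-- most once along a surviving run, every step of S keeps a quarter of the count, and the at most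
-- 1 + |S| choices of where (if at all) j is marked give (1 + |S|) 4 ^ -|S|.

open import Defs
open import Data.Bool using (Bool; true; false; if_then_else_; _∧_; not)
open import Data.Bool.Properties using (if-float; T-≡)
open import Data.Empty using (⊥-elim)
import Data.Fin as Fin
open import Data.Fin.Subset using (Subset; inside; outside; _∈_; ∣_∣)
open import Data.Fin.Subset.Properties using (drop-there)
open import Data.List using (List; []; _∷_; length; filterᵇ; concatMap; map; _++_)
open import Data.Nat using (ℕ; suc; _≡ᵇ_; _+_; _*_; _^_; _≤_; z≤n)
open import Data.Nat.Properties
open import Data.Nat.Tactic.RingSolver using (solve-∀)
open import Data.Product using (_×_; _,_; proj₁; proj₂)
open import Data.Sum using (_⊎_; inj₁; inj₂)
open import Data.Vec using (Vec; []; _∷_; lookup; here; there)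
open import Function using (_∘_; Equivalence)
open import Relation.Nullary using (¬_; yes; no)
open import Relation.Binary.PropositionalEquality
open import Algebra.Properties.CommutativeSemigroup +-commutativeSemigroup using (interchange)
open import Algebra.Properties.CommutativeSemigroup *-commutativeSemigroup using (x∙yz≈y∙xz)

private variable
  A : Set

-- Defs.update st m v is definitionally st [ m ≔ v ].
infixl 6 _[_≔_]
_[_≔_] : (ℕ → A) → ℕ → A → ℕ → A
(f [ m ≔ v ]) x = if x ≡ᵇ m then v else f x

≡ᵇ-refl : ∀ n → (n ≡ᵇ n) ≡ true
≡ᵇ-refl n = Equivalence.to T-≡ (≡⇒≡ᵇ n n refl)

≢⇒≡ᵇ-false : ∀ {m n} → m ≢ n → (m ≡ᵇ n) ≡ false
≢⇒≡ᵇ-false {m} {n} m≢n with m ≡ᵇ n in eq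
... | true  = ⊥-elim (m≢n (≡ᵇ⇒≡ m n (Equivalence.from T-≡ eq)))
... | false = refl

[≔]-hit : ∀ (f : ℕ → A) m v → (f [ m ≔ v ]) m ≡ v
[≔]-hit f m v rewrite ≡ᵇ-refl m = refl

[≔]-miss : ∀ (f : ℕ → A) {m x} v → x ≢ m → (f [ m ≔ v ]) x ≡ f x
[≔]-miss f v x≢m rewrite ≢⇒≡ᵇ-false x≢m = refl

[≔]-idem : ∀ (f : ℕ → A) m v w → f [ m ≔ v ] [ m ≔ w ] ≗ f [ m ≔ w ]
[≔]-idem f m v w x with x ≡ᵇ m
... | true  = refl
... | false = refl

[≔]-comm : ∀ (f : ℕ → A) {m m′} v w → m ≢ m′ →
  f [ m ≔ v ] [ m′ ≔ w ] ≗ f [ m′ ≔ w ] [ m ≔ v ]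
[≔]-comm f {m} {m′} v w m≢m′ x with x ≟ m
... | yes refl rewrite ≡ᵇ-refl x | ≢⇒≡ᵇ-false m≢m′ = refl
... | no x≢m rewrite ≢⇒≡ᵇ-false x≢m with x ≡ᵇ m′
...   | true  = refl
...   | false = refl

[≔]-self : ∀ (f : ℕ → A) {m v} → f m ≡ v → f [ m ≔ v ] ≗ f
[≔]-self f {m} fm≡v x with x ≟ m
... | yes refl = trans ([≔]-hit f x _) (sym fm≡v)
... | no x≢m   = [≔]-miss f _ x≢m

[≔]-cong : ∀ {f g : ℕ → A} → f ≗ g → ∀ m v → f [ m ≔ v ] ≗ g [ m ≔ v ]
[≔]-cong f≗g m v x with x ≡ᵇ m
... | true  = refl
... | false = f≗g x

∘-[≔] : ∀ {B : Set} (h : A → B) (f : ℕ → A) m v → h ∘ (f [ m ≔ v ]) ≗ (h ∘ f) [ m ≔ h v ]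
∘-[≔] h f m v x = if-float h (x ≡ᵇ m)

count : (A → Bool) → List A → ℕ
count p []       = 0
count p (x ∷ xs) = (if p x then 1 else 0) + count p xs

length-filterᵇ : ∀ (p : A → Bool) xs → length (filterᵇ p xs) ≡ count p xs
length-filterᵇ p []       = refl
length-filterᵇ p (x ∷ xs) with p x
... | true  = cong suc (length-filterᵇ p xs)
... | false = length-filterᵇ p xs

count-++ : ∀ (p : A → Bool) xs ys → count p (xs ++ ys) ≡ count p xs + count p ys
count-++ p []       ys = refl
count-++ p (x ∷ xs) ys =
  trans (cong (_ +_) (count-++ p xs ys)) (sym (+-assoc (if p x then 1 else 0) _ _))

count-cong : ∀ {p q : A → Bool} → p ≗ q → count p ≗ count q
count-cong p≗q []       = refl
count-cong p≗q (x ∷ xs) =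
  cong₂ _+_ (cong (λ b → if b then 1 else 0) (p≗q x)) (count-cong p≗q xs)

count-∧ : ∀ b (q : A → Bool) xs → count (λ x → b ∧ q x) xs ≡ (if b then count q xs else 0)
count-∧ true  q xs       = refl
count-∧ false q []       = refl
count-∧ false q (x ∷ xs) = count-∧ false q xs

sumBool : (Bool → ℕ) → ℕ
sumBool f = f true + f false

sumCoins : (Coins → ℕ) → ℕ
sumCoins f = sumBool λ c₁ → sumBool λ c₂ → f (c₁ , c₂)

sumBool-+ : ∀ f g → sumBool (λ b → f b + g b) ≡ sumBool f + sumBool g
sumBool-+ f g = interchange (f true) (g true) (f false) (g false)

sumCoins-+ : ∀ f g → sumCoins (λ c → f c + g c) ≡ sumCoins f + sumCoins g
sumCoins-+ f g =
  trans (cong₂ _+_ (sumBool-+ (λ c₂ → f (true , c₂)) (λ c₂ → g (true , c₂)))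
                   (sumBool-+ (λ c₂ → f (false , c₂)) (λ c₂ → g (false , c₂))))
        (sumBool-+ (λ c₁ → sumBool λ c₂ → f (c₁ , c₂)) (λ c₁ → sumBool λ c₂ → g (c₁ , c₂)))

sumBool-double : ∀ {f g h} → (∀ b → f b + f b ≡ g b + h b) →
  sumBool f + sumBool f ≡ sumBool g + sumBool h
sumBool-double {f} {g} {h} p = begin
  (f true + f false) + (f true + f false) ≡⟨ interchange (f true) (f false) (f true) (f false) ⟩
  (f true + f true) + (f false + f false) ≡⟨ cong₂ _+_ (p true) (p false) ⟩
  (g true + h true) + (g false + h false) ≡⟨ interchange (g true) (h true) (g false) (h false) ⟩
  (g true + g false) + (h true + h false) ∎
  where open ≡-Reasoning

if-double : ∀ b {x y z} → x + x ≡ y + z →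
  (if b then x else 0) + (if b then x else 0) ≡ (if b then y else 0) + (if b then z else 0)
if-double true  p = p
if-double false p = refl

coins : List Coins
coins = (true , true) ∷ (true , false) ∷ (false , true) ∷ (false , false) ∷ []

count-coins : ∀ (p : Coins → Bool) → count p coins ≡ sumCoins λ c → if p c then 1 else 0
count-coins p =
  trans (cong (λ n → ind (true , true) + (ind (true , false) + (ind (false , true) + n))) (+-identityʳ _))
        (sym (+-assoc (ind (true , true)) _ _))
  where
  ind : Coins → ℕ
  ind c = if p c then 1 else 0

count-allCoins-suc : ∀ {T} (p : Vec Coins (suc T) → Bool) →
  count p (allCoins (suc T)) ≡ sumCoins λ c → count (p ∘ (c ∷_)) (allCoins T)
count-allCoins-suc {T} p = extend (allCoins T)
  where
  open ≡-Reasoning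
  extend : ∀ vs → count p (concatMap (λ v → map (_∷ v) coins) vs) ≡ sumCoins λ c → count (p ∘ (c ∷_)) vs
  extend []       = refl
  extend (v ∷ vs) = begin
    count p (map (_∷ v) coins ++ concatMap (λ v → map (_∷ v) coins) vs)
      ≡⟨ count-++ p (map (_∷ v) coins) (concatMap (λ v → map (_∷ v) coins) vs) ⟩
    count p (map (_∷ v) coins) + count p (concatMap (λ v → map (_∷ v) coins) vs)
      ≡⟨ cong₂ _+_ (count-coins (λ c → p (c ∷ v))) (extend vs) ⟩
    sumCoins (λ c → if p (c ∷ v) then 1 else 0) + sumCoins (λ c → count (p ∘ (c ∷_)) vs)
      ≡⟨ sumCoins-+ (λ c → if p (c ∷ v) then 1 else 0) (λ c → count (p ∘ (c ∷_)) vs) ⟨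
    sumCoins (λ c → count (p ∘ (c ∷_)) (v ∷ vs)) ∎

-- markedOnce w: the selection at the first step marked with m is recorded (w = "m was selected").
-- markedOnceDeferred: that selection is not revealed yet; it is decided by the coin of the second
-- step marked with m.
data Mark⁺ : Set where
  unmarked           : Mark⁺
  markedOnce         : Bool → Mark⁺
  markedOnceDeferred : Mark⁺
  markedMore         : Mark⁺

State⁺ : Set
State⁺ = ℕ → Mark⁺

pick : Bool → ℕ → ℕ → ℕ
pick c x y = if c then x else y

-- m is the marked agent, o its partner, and the coin c reads "select m" wherever a uniform
-- choice is made.
selection : ℕ → ℕ → Bool → Mark⁺ → ℕ
selection m o c unmarked           = pick c m o
selection m o c (markedOnce w)     = pick w o m
selection m o c markedOnceDeferred = selection m o c (markedOnce c)
selection m o c markedMore         = pick c m o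

nextMark : Bool → Mark⁺ → Mark⁺
nextMark c unmarked = markedOnce c
nextMark c _        = markedMore

avoids : ℕ → Bool → ℕ → Bool
avoids j inside  x = not (x ≡ᵇ j)
avoids j outside x = true

payoff : ℕ → Bool → ℕ → ℕ → Mark⁺ → State⁺ → (State⁺ → ℕ) → Bool → ℕ
payoff j s m o v st K c = if avoids j s (selection m o c v) then K (st [ m ≔ nextMark c v ]) else 0

markPayoff : ℕ → Bool → ℕ → ℕ → Mark⁺ → State⁺ → (State⁺ → ℕ) → ℕ
markPayoff j s m o v st K = sumBool (payoff j s m o v st K)

survivors : ∀ {T} → ℕ → Vec TwoWay T → Subset T → State⁺ → ℕ
survivors j []             []      st = 1
survivors j ((a , b) ∷ τs) (s ∷ S) st =
  sumBool λ c₁ → markPayoff j s (pick c₁ a b) (pick c₁ b a) (st (pick c₁ a b)) st (survivors j τs S)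

Extensional : (State⁺ → ℕ) → Set
Extensional K = ∀ {st st′} → st ≗ st′ → K st ≡ K st′

markPayoff-cong : ∀ j s m o v (K : State⁺ → ℕ) (st st′ : State⁺) →
  (∀ v′ → K (st [ m ≔ v′ ]) ≡ K (st′ [ m ≔ v′ ])) →
  markPayoff j s m o v st K ≡ markPayoff j s m o v st′ K
markPayoff-cong j s m o v K st st′ eq = cong₂ _+_ (same true) (same false)
  where
  same : ∀ c → payoff j s m o v st K c ≡ payoff j s m o v st′ K c
  same c = cong (λ n → if avoids j s (selection m o c v) then n else 0) (eq (nextMark c v))

survivors-cong : ∀ {T} j (τ : Vec TwoWay T) S → Extensional (survivors j τ S)
survivors-cong j []             []      eq = refl
survivors-cong j ((a , b) ∷ τs) (s ∷ S) {st} {st′} eq = cong₂ _+_ (marking a b) (marking b a)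
  where
  marking : ∀ m o → markPayoff j s m o (st m) st (survivors j τs S)
                  ≡ markPayoff j s m o (st′ m) st′ (survivors j τs S)
  marking m o rewrite eq m =
    markPayoff-cong j s m o (st′ m) (survivors j τs S) st st′ λ v →
      survivors-cong j τs S ([≔]-cong eq m v)

toMark⁺ : Mark → Mark⁺
toMark⁺ unmarked       = unmarked
toMark⁺ (markedOnce w) = markedOnce w
toMark⁺ markedMore     = markedMore

pick-not : ∀ c x y → pick (not c) y x ≡ pick c x y
pick-not true  x y = refl
pick-not false x y = refl

pick-≡ᵇ-first : ∀ c {x y} → y ≢ x → (pick c x y ≡ᵇ x) ≡ c
pick-≡ᵇ-first true  {x} y≢x = ≡ᵇ-refl x
pick-≡ᵇ-first false     y≢x = ≢⇒≡ᵇ-false y≢x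

pick-≡ᵇ-second : ∀ c {x y} → x ≢ y → (pick c x y ≡ᵇ y) ≡ not c
pick-≡ᵇ-second true          x≢y = ≢⇒≡ᵇ-false x≢y
pick-≡ᵇ-second false {y = y} x≢y = ≡ᵇ-refl y

-- a ≢ b makes the flag sel ≡ᵇ m recorded by step equal to the coin c.
step-marking : ∀ (st : State) {a b} → a ≢ b → ∀ c₁ c₂ →
  let m = pick c₁ a b; o = pick c₁ b a; c = if c₁ then c₂ else not c₂ in
  proj₁ (step st (a , b) (c₁ , c₂)) ≡ selection m o c (toMark⁺ (st m)) ×
  toMark⁺ ∘ proj₂ (step st (a , b) (c₁ , c₂)) ≗ (toMark⁺ ∘ st) [ m ≔ nextMark c (toMark⁺ (st m)) ]
step-marking st {a} {b} a≢b true c₂ with st a in e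
... | unmarked rewrite pick-≡ᵇ-first c₂ (a≢b ∘ sym) = refl , ∘-[≔] toMark⁺ st a _
... | markedOnce w = refl , ∘-[≔] toMark⁺ st a markedMore
... | markedMore   = refl , sym ∘ [≔]-self (toMark⁺ ∘ st) (cong toMark⁺ e)
step-marking st {a} {b} a≢b false c₂ with st b in e
... | unmarked rewrite pick-≡ᵇ-second c₂ a≢b = sym (pick-not c₂ a b) , ∘-[≔] toMark⁺ st b _
... | markedOnce w = refl , ∘-[≔] toMark⁺ st b markedMore
... | markedMore   = sym (pick-not c₂ a b) , sym ∘ [≔]-self (toMark⁺ ∘ st) (cong toMark⁺ e)

countFrom : ∀ {T} → ℕ → Vec TwoWay T → Subset T → State → ℕ
countFrom {T} j τ S st = count (λ cs → noneSelected j S (runFrom st τ cs)) (allCoins T)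

Distinct : ∀ {T} → Vec TwoWay T → Set
Distinct τ = ∀ t → proj₁ (lookup τ t) ≢ proj₂ (lookup τ t)

noneSelected-∷ : ∀ {T} j s (S : Subset T) x xs →
  noneSelected j (s ∷ S) (x ∷ xs) ≡ avoids j s x ∧ noneSelected j S xs
noneSelected-∷ j inside  S x xs = refl
noneSelected-∷ j outside S x xs = refl

countFrom-survivors : ∀ {T} j (τ : Vec TwoWay T) S (st : State) → Distinct τ →
  countFrom j τ S st ≡ survivors j τ S (toMark⁺ ∘ st)
countFrom-survivors j []             []      st distinct = refl
countFrom-survivors {suc T} j ((a , b) ∷ τs) (s ∷ S) st distinct =
  trans (count-allCoins-suc (λ cs → noneSelected j (s ∷ S) (runFrom st ((a , b) ∷ τs) cs)))
        (cong₂ _+_ (cong₂ _+_ (coin true true) (coin true false))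
                   (trans (cong₂ _+_ (coin false true) (coin false false))
                          (+-comm (markingB false) (markingB true))))
  where
  open ≡-Reasoning
  markingB : Bool → ℕ
  markingB = payoff j s b a (toMark⁺ (st b)) (toMark⁺ ∘ st) (survivors j τs S)
  coin : ∀ c₁ c₂ →
    count (λ cs → noneSelected j (s ∷ S) (runFrom st ((a , b) ∷ τs) ((c₁ , c₂) ∷ cs))) (allCoins T) ≡
    payoff j s (pick c₁ a b) (pick c₁ b a) (toMark⁺ (st (pick c₁ a b))) (toMark⁺ ∘ st) (survivors j τs S)
           (if c₁ then c₂ else not c₂)
  coin c₁ c₂ = begin
    count (λ cs → noneSelected j (s ∷ S) (sel ∷ runFrom st′ τs cs)) (allCoins T)
      ≡⟨ count-cong (λ cs → noneSelected-∷ j s S sel (runFrom st′ τs cs)) (allCoins T) ⟩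
    count (λ cs → avoids j s sel ∧ noneSelected j S (runFrom st′ τs cs)) (allCoins T)
      ≡⟨ count-∧ (avoids j s sel) _ (allCoins T) ⟩
    (if avoids j s sel then countFrom j τs S st′ else 0)
      ≡⟨ cong₂ (λ x n → if avoids j s x then n else 0) (proj₁ (step-marking st (distinct Fin.zero) c₁ c₂))
               (trans (countFrom-survivors j τs S st′ (distinct ∘ Fin.suc))
                      (survivors-cong j τs S (proj₂ (step-marking st (distinct Fin.zero) c₁ c₂)))) ⟩
    payoff j s (pick c₁ a b) (pick c₁ b a) (toMark⁺ (st (pick c₁ a b))) (toMark⁺ ∘ st) (survivors j τs S)
           (if c₁ then c₂ else not c₂) ∎
    where
    sel : ℕ
    sel = proj₁ (step st (a , b) (c₁ , c₂))
    st′ : State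
    st′ = proj₂ (step st (a , b) (c₁ , c₂))

Deferrable : ℕ → (State⁺ → ℕ) → Set
Deferrable m K = ∀ st → K (st [ m ≔ markedOnceDeferred ]) + K (st [ m ≔ markedOnceDeferred ])
                      ≡ K (st [ m ≔ markedOnce true ]) + K (st [ m ≔ markedOnce false ])

markPayoff-deferred : ∀ j s m o (st : State⁺) K →
  markPayoff j s m o markedOnceDeferred st K + markPayoff j s m o markedOnceDeferred st K ≡
  markPayoff j s m o (markedOnce true) st K + markPayoff j s m o (markedOnce false) st K
markPayoff-deferred j s m o st K =
  interchange (revealed true) (revealed false) (revealed true) (revealed false)
  where
  revealed : Bool → ℕ
  revealed w = payoff j s m o (markedOnce w) st K w

markPayoff-overwrite : ∀ {K} → Extensional K → ∀ j s m o v st w →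
  markPayoff j s m o v (st [ m ≔ w ]) K ≡ markPayoff j s m o v st K
markPayoff-overwrite {K} ext j s m o v st w =
  markPayoff-cong j s m o v K (st [ m ≔ w ]) st λ v′ → ext ([≔]-idem st m w v′)

markPayoff-deferrable : ∀ {K m} → Extensional K → Deferrable m K →
  ∀ j s x y → Deferrable m (λ st → markPayoff j s x y (st x) st K)
markPayoff-deferrable {K} {m} ext deferrable j s x y st with x ≟ m
... | yes refl
  rewrite [≔]-hit st x markedOnceDeferred | [≔]-hit st x (markedOnce true) | [≔]-hit st x (markedOnce false)
        | markPayoff-overwrite ext j s x y markedOnceDeferred st markedOnceDeferred
        | markPayoff-overwrite ext j s x y (markedOnce true) st (markedOnce true)
        | markPayoff-overwrite ext j s x y (markedOnce false) st (markedOnce false)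
  = markPayoff-deferred j s x y st K
... | no x≢m
  rewrite [≔]-miss st markedOnceDeferred x≢m | [≔]-miss st (markedOnce true) x≢m
        | [≔]-miss st (markedOnce false) x≢m
  = sumBool-double {coin markedOnceDeferred} {coin (markedOnce true)} {coin (markedOnce false)} λ c →
      if-double (avoids j s (selection x y c (st x))) (deferredAfter (nextMark c (st x)))
  where
  coin : Mark⁺ → Bool → ℕ
  coin v = payoff j s x y (st x) (st [ m ≔ v ]) K
  reorder : ∀ v w → K (st [ m ≔ v ] [ x ≔ w ]) ≡ K (st [ x ≔ w ] [ m ≔ v ])
  reorder v w = ext ([≔]-comm st v w (x≢m ∘ sym))
  deferredAfter : ∀ w →
    K (st [ m ≔ markedOnceDeferred ] [ x ≔ w ]) + K (st [ m ≔ markedOnceDeferred ] [ x ≔ w ]) ≡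
    K (st [ m ≔ markedOnce true ] [ x ≔ w ]) + K (st [ m ≔ markedOnce false ] [ x ≔ w ])
  deferredAfter w = begin
    K (st [ m ≔ markedOnceDeferred ] [ x ≔ w ]) + K (st [ m ≔ markedOnceDeferred ] [ x ≔ w ])
      ≡⟨ cong₂ _+_ (reorder markedOnceDeferred w) (reorder markedOnceDeferred w) ⟩
    K (st [ x ≔ w ] [ m ≔ markedOnceDeferred ]) + K (st [ x ≔ w ] [ m ≔ markedOnceDeferred ])
      ≡⟨ deferrable (st [ x ≔ w ]) ⟩
    K (st [ x ≔ w ] [ m ≔ markedOnce true ]) + K (st [ x ≔ w ] [ m ≔ markedOnce false ])
      ≡⟨ cong₂ _+_ (reorder (markedOnce true) w) (reorder (markedOnce false) w) ⟨
    K (st [ m ≔ markedOnce true ] [ x ≔ w ]) + K (st [ m ≔ markedOnce false ] [ x ≔ w ]) ∎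
    where open ≡-Reasoning

survivors-deferrable : ∀ {T} j (τ : Vec TwoWay T) S m → Deferrable m (survivors j τ S)
survivors-deferrable j []             []      m st = refl
survivors-deferrable j ((a , b) ∷ τs) (s ∷ S) m st =
  sumBool-double {marked (st [ m ≔ markedOnceDeferred ])} {marked (st [ m ≔ markedOnce true ])}
                 {marked (st [ m ≔ markedOnce false ])}
    λ c₁ → markPayoff-deferrable (survivors-cong j τs S) (survivors-deferrable j τs S m)
                                 j s (pick c₁ a b) (pick c₁ b a) st
  where
  marked : State⁺ → Bool → ℕ
  marked st′ c₁ = markPayoff j s (pick c₁ a b) (pick c₁ b a) (st′ (pick c₁ a b)) st′ (survivors j τs S)

data AvoidingFlag (j : ℕ) : ℕ → Bool → Set where
  own   : AvoidingFlag j j false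
  other : ∀ {x} → x ≢ j → AvoidingFlag j x true

FlagAvoids : ℕ → ℕ → Mark⁺ → Set
FlagAvoids j x v = ∀ {w} → v ≡ markedOnce w → AvoidingFlag j x w

-- Every revealed flag was recorded at a step that avoided j, so the second step marked with x
-- selects j whenever it involves j.
Doomed : ℕ → State⁺ → Set
Doomed j st = ∀ x → FlagAvoids j x (st x)

data AvoidingTransition (j m : ℕ) : Mark⁺ → Mark⁺ → Set where
  first  : ∀ {w} → AvoidingFlag j m w → AvoidingTransition j m unmarked (markedOnce w)
  second : AvoidingTransition j m markedOnceDeferred markedMore
  later  : AvoidingTransition j m markedMore markedMore

Doomed-[≔] : ∀ {j st m v} → Doomed j st → FlagAvoids j m v → Doomed j (st [ m ≔ v ])
Doomed-[≔] {st = st} {m} {v} doomed flag x e with x ≟ m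
... | yes refl = flag (trans (sym ([≔]-hit st x v)) e)
... | no x≢m   = doomed x (trans (sym ([≔]-miss st v x≢m)) e)

Doomed-transition : ∀ {j st m v v′} → Doomed j st → AvoidingTransition j m v v′ → Doomed j (st [ m ≔ v′ ])
Doomed-transition doomed (first flag) = Doomed-[≔] doomed λ { refl → flag }
Doomed-transition doomed second       = Doomed-[≔] doomed λ ()
Doomed-transition doomed later        = Doomed-[≔] doomed λ ()

markPayoff-inside-own : ∀ {j o} → o ≢ j → ∀ v → FlagAvoids j j v →
  ∀ st K k B → (∀ {v′} → AvoidingTransition j j v v′ → K (st [ j ≔ v′ ]) * k ≤ B) →
  markPayoff j inside j o v st K * k ≤ B
markPayoff-inside-own {j} o≢j unmarked flag st K k B bound
  rewrite ≡ᵇ-refl j | ≢⇒≡ᵇ-false o≢j = bound (first own)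
markPayoff-inside-own {j} o≢j (markedOnce w) flag st K k B bound with flag refl
... | own rewrite ≡ᵇ-refl j = z≤n
... | other j≢j = ⊥-elim (j≢j refl)
markPayoff-inside-own {j} o≢j markedOnceDeferred flag st K k B bound
  rewrite ≡ᵇ-refl j | ≢⇒≡ᵇ-false o≢j | +-identityʳ (K (st [ j ≔ markedMore ])) = bound second
markPayoff-inside-own {j} o≢j markedMore flag st K k B bound
  rewrite ≡ᵇ-refl j | ≢⇒≡ᵇ-false o≢j = bound later

markPayoff-inside-partner : ∀ {j m} → m ≢ j → ∀ v → FlagAvoids j m v →
  ∀ st K k B → (∀ {v′} → AvoidingTransition j m v v′ → K (st [ m ≔ v′ ]) * k ≤ B) →
  markPayoff j inside m j v st K * k ≤ B
markPayoff-inside-partner {j} {m} m≢j unmarked flag st K k B bound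
  rewrite ≡ᵇ-refl j | ≢⇒≡ᵇ-false m≢j | +-identityʳ (K (st [ m ≔ markedOnce true ])) =
  bound (first (other m≢j))
markPayoff-inside-partner {j} m≢j (markedOnce w) flag st K k B bound with flag refl
... | own     = ⊥-elim (m≢j refl)
... | other _ rewrite ≡ᵇ-refl j = z≤n
markPayoff-inside-partner {j} m≢j markedOnceDeferred flag st K k B bound
  rewrite ≡ᵇ-refl j | ≢⇒≡ᵇ-false m≢j = bound second
markPayoff-inside-partner {j} {m} m≢j markedMore flag st K k B bound
  rewrite ≡ᵇ-refl j | ≢⇒≡ᵇ-false m≢j | +-identityʳ (K (st [ m ≔ markedMore ])) = bound later

+-*-≤ : ∀ x y {k B₁ B₂} → x * k ≤ B₁ → y * k ≤ B₂ → (x + y) * k ≤ B₁ + B₂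
+-*-≤ x y {k} {B₁} {B₂} p q = subst (_≤ B₁ + B₂) (sym (*-distribʳ-+ k x y)) (+-mono-≤ p q)

scaled-≤ : ∀ x c {k B} → x * k ≤ B → x * (c * k) ≤ c * B
scaled-≤ x c {k} {B} p = subst (_≤ c * B) (sym (x∙yz≈y∙xz x c k)) (*-monoʳ-≤ c p)

quadruple : ∀ x → (x + x) + (x + x) ≡ 4 * x
quadruple = solve-∀

double-twice : ∀ x → 2 * (x + x) ≡ 4 * x
double-twice = solve-∀

-- This is where deferral is used: a first marking outside S leaves its flag unrevealed, which keeps
-- Doomed intact.
markPayoff-outside : ∀ {T} j m o v (τs : Vec TwoWay T) S st k B →
  survivors j τs S (st [ m ≔ markedOnceDeferred ]) * k ≤ B →
  survivors j τs S (st [ m ≔ markedMore ]) * k ≤ B →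
  markPayoff j outside m o v st (survivors j τs S) * k ≤ B + B
markPayoff-outside j m o unmarked τs S st k B deferred _ =
  subst (λ n → n * k ≤ B + B) (survivors-deferrable j τs S m st)
    (+-*-≤ afterDeferred _ deferred deferred)
  where
  afterDeferred : ℕ
  afterDeferred = survivors j τs S (st [ m ≔ markedOnceDeferred ])
markPayoff-outside j m o (markedOnce w)     τs S st k B _ more =
  +-*-≤ (survivors j τs S (st [ m ≔ markedMore ])) _ more more
markPayoff-outside j m o markedOnceDeferred τs S st k B _ more =
  +-*-≤ (survivors j τs S (st [ m ≔ markedMore ])) _ more more
markPayoff-outside j m o markedMore         τs S st k B _ more =
  +-*-≤ (survivors j τs S (st [ m ≔ markedMore ])) _ more more

survivors-outside : ∀ {T} j a b (τs : Vec TwoWay T) S st k B →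
  (∀ c₁ → survivors j τs S (st [ pick c₁ a b ≔ markedOnceDeferred ]) * k ≤ B) →
  (∀ c₁ → survivors j τs S (st [ pick c₁ a b ≔ markedMore ]) * k ≤ B) →
  survivors j ((a , b) ∷ τs) (outside ∷ S) st * k ≤ 4 * B
survivors-outside j a b τs S st k B deferred more =
  ≤-trans (+-*-≤ (marked true) (marked false) (marking true) (marking false)) (≤-reflexive (quadruple B))
  where
  marked : Bool → ℕ
  marked c₁ = markPayoff j outside (pick c₁ a b) (pick c₁ b a) (st (pick c₁ a b)) st (survivors j τs S)
  marking : ∀ c₁ → marked c₁ * k ≤ B + B
  marking c₁ =
    markPayoff-outside j (pick c₁ a b) (pick c₁ b a) (st (pick c₁ a b)) τs S st k B (deferred c₁) (more c₁)

survivors-inside : ∀ {T} j a b (τs : Vec TwoWay T) S st → a ≢ b → Involves j (a , b) → Doomed j st →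
  ∀ k Bj Bo →
  (∀ {v′} → AvoidingTransition j j (st j) v′ → survivors j τs S (st [ j ≔ v′ ]) * k ≤ Bj) →
  (∀ {o v′} → o ≢ j → AvoidingTransition j o (st o) v′ → survivors j τs S (st [ o ≔ v′ ]) * k ≤ Bo) →
  survivors j ((a , b) ∷ τs) (inside ∷ S) st * k ≤ Bj + Bo
survivors-inside j .j b τs S st j≢b (inj₁ refl) doomed k Bj Bo boundOwn boundPartner =
  +-*-≤ (marked j b) (marked b j)
    (markPayoff-inside-own (j≢b ∘ sym) (st j) (doomed j) st (survivors j τs S) k Bj boundOwn)
    (markPayoff-inside-partner (j≢b ∘ sym) (st b) (doomed b) st (survivors j τs S) k Bo
       (boundPartner (j≢b ∘ sym)))
  where
  marked : ℕ → ℕ → ℕ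
  marked m o = markPayoff j inside m o (st m) st (survivors j τs S)
survivors-inside j a .j τs S st a≢j (inj₂ refl) doomed k Bj Bo boundOwn boundPartner =
  subst (λ n → n * k ≤ Bj + Bo) (+-comm (marked j a) (marked a j))
    (+-*-≤ (marked j a) (marked a j)
      (markPayoff-inside-own a≢j (st j) (doomed j) st (survivors j τs S) k Bj boundOwn)
      (markPayoff-inside-partner a≢j (st a) (doomed a) st (survivors j τs S) k Bo (boundPartner a≢j)))
  where
  marked : ℕ → ℕ → ℕ
  marked m o = markPayoff j inside m o (st m) st (survivors j τs S)

InvolvedAt : ∀ {T} → ℕ → Vec TwoWay T → Subset T → Set
InvolvedAt j τ S = ∀ t → t ∈ S → Involves j (lookup τ t)

InvolvedAt-tail : ∀ {T j τ s} {τs : Vec TwoWay T} {S} → InvolvedAt j (τ ∷ τs) (s ∷ S) → InvolvedAt j τs S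
InvolvedAt-tail involved t t∈S = involved (Fin.suc t) (there t∈S)

survivors-involved-bound : ∀ {T} j (τ : Vec TwoWay T) S → Distinct τ → InvolvedAt j τ S →
  ∀ st → Doomed j st → survivors j τ S st * 2 ^ ∣ S ∣ ≤ 4 ^ T
survivors-involved-bound j []             []            distinct involved st doomed = ≤-refl
survivors-involved-bound {suc T} j ((a , b) ∷ τs) (outside ∷ S) distinct involved st doomed =
  survivors-outside j a b τs S st (2 ^ ∣ S ∣) (4 ^ T)
    (λ _ → IH _ (Doomed-[≔] doomed λ ())) (λ _ → IH _ (Doomed-[≔] doomed λ ()))
  where
  IH : ∀ st → Doomed j st → survivors j τs S st * 2 ^ ∣ S ∣ ≤ 4 ^ T
  IH = survivors-involved-bound j τs S (distinct ∘ Fin.suc) (InvolvedAt-tail involved)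
survivors-involved-bound {suc T} j ((a , b) ∷ τs) (inside ∷ S) distinct involved st doomed =
  ≤-trans (scaled-≤ (survivors j ((a , b) ∷ τs) (inside ∷ S) st) 2
             (survivors-inside j a b τs S st (distinct Fin.zero) (involved Fin.zero here) doomed
                (2 ^ ∣ S ∣) (4 ^ T) (4 ^ T)
                (λ t → IH _ (Doomed-transition doomed t)) (λ _ t → IH _ (Doomed-transition doomed t))))
          (≤-reflexive (double-twice (4 ^ T)))
  where
  IH : ∀ st → Doomed j st → survivors j τs S st * 2 ^ ∣ S ∣ ≤ 4 ^ T
  IH = survivors-involved-bound j τs S (distinct ∘ Fin.suc) (InvolvedAt-tail involved)

InvolvedExactlyAt : ∀ {T} → ℕ → Vec TwoWay T → Subset T → Set
InvolvedExactlyAt j τ S = ∀ t → (t ∈ S → Involves j (lookup τ t)) × (Involves j (lookup τ t) → t ∈ S)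

InvolvedExactlyAt-tail : ∀ {T j τ s} {τs : Vec TwoWay T} {S} →
  InvolvedExactlyAt j (τ ∷ τs) (s ∷ S) → InvolvedExactlyAt j τs S
InvolvedExactlyAt-tail exact t =
  (λ t∈S → proj₁ (exact (Fin.suc t)) (there t∈S)) ,
  (λ involves → drop-there (proj₂ (exact (Fin.suc t)) involves))

InvolvedExactlyAt-outside : ∀ {T j a b} {τs : Vec TwoWay T} {S} →
  InvolvedExactlyAt j ((a , b) ∷ τs) (outside ∷ S) → ∀ c₁ → j ≢ pick c₁ a b
InvolvedExactlyAt-outside exact true  j≡a with proj₂ (exact Fin.zero) (inj₁ j≡a)
... | ()
InvolvedExactlyAt-outside exact false j≡b with proj₂ (exact Fin.zero) (inj₂ j≡b)
... | ()

survivors-exact-bound-markedOnce : ∀ {T} j (τ : Vec TwoWay T) S → Distinct τ → InvolvedExactlyAt j τ S →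
  ∀ st → Doomed j st → st j ≡ markedOnce false → survivors j τ S st * 4 ^ ∣ S ∣ ≤ 4 ^ T
survivors-exact-bound-markedOnce j []             []            distinct exact st doomed stj = ≤-refl
survivors-exact-bound-markedOnce {suc T} j ((a , b) ∷ τs) (outside ∷ S) distinct exact st doomed stj =
  survivors-outside j a b τs S st (4 ^ ∣ S ∣) (4 ^ T)
    (λ c₁ → IH _ (Doomed-[≔] doomed λ ()) (untouched c₁))
    (λ c₁ → IH _ (Doomed-[≔] doomed λ ()) (untouched c₁))
  where
  IH : ∀ st → Doomed j st → st j ≡ markedOnce false → survivors j τs S st * 4 ^ ∣ S ∣ ≤ 4 ^ T
  IH = survivors-exact-bound-markedOnce j τs S (distinct ∘ Fin.suc) (InvolvedExactlyAt-tail exact)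
  untouched : ∀ c₁ {v} → (st [ pick c₁ a b ≔ v ]) j ≡ markedOnce false
  untouched c₁ {v} = trans ([≔]-miss st v (InvolvedExactlyAt-outside exact c₁)) stj
survivors-exact-bound-markedOnce {suc T} j ((a , b) ∷ τs) (inside ∷ S) distinct exact st doomed stj =
  scaled-≤ (survivors j ((a , b) ∷ τs) (inside ∷ S) st) 4
    (survivors-inside j a b τs S st (distinct Fin.zero) (proj₁ (exact Fin.zero) here) doomed
       (4 ^ ∣ S ∣) 0 (4 ^ T)
       (λ t → ⊥-elim (noSecondMark (subst (λ v → AvoidingTransition j j v _) stj t)))
       (λ o≢j t → IH _ (Doomed-transition doomed t) (trans ([≔]-miss st _ (o≢j ∘ sym)) stj)))
  where
  IH : ∀ st → Doomed j st → st j ≡ markedOnce false → survivors j τs S st * 4 ^ ∣ S ∣ ≤ 4 ^ T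
  IH = survivors-exact-bound-markedOnce j τs S (distinct ∘ Fin.suc) (InvolvedExactlyAt-tail exact)
  noSecondMark : ∀ {v′} → ¬ AvoidingTransition j j (markedOnce false) v′
  noSecondMark ()

survivors-exact-bound-unmarked : ∀ {T} j (τ : Vec TwoWay T) S → Distinct τ → InvolvedExactlyAt j τ S →
  ∀ st → Doomed j st → st j ≡ unmarked → survivors j τ S st * 4 ^ ∣ S ∣ ≤ (1 + ∣ S ∣) * 4 ^ T
survivors-exact-bound-unmarked j []             []            distinct exact st doomed stj = ≤-refl
survivors-exact-bound-unmarked {suc T} j ((a , b) ∷ τs) (outside ∷ S) distinct exact st doomed stj =
  ≤-trans (survivors-outside j a b τs S st (4 ^ ∣ S ∣) ((1 + ∣ S ∣) * 4 ^ T)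
             (λ c₁ → IH _ (Doomed-[≔] doomed λ ()) (untouched c₁))
             (λ c₁ → IH _ (Doomed-[≔] doomed λ ()) (untouched c₁)))
          (≤-reflexive (x∙yz≈y∙xz 4 (1 + ∣ S ∣) (4 ^ T)))
  where
  IH : ∀ st → Doomed j st → st j ≡ unmarked → survivors j τs S st * 4 ^ ∣ S ∣ ≤ (1 + ∣ S ∣) * 4 ^ T
  IH = survivors-exact-bound-unmarked j τs S (distinct ∘ Fin.suc) (InvolvedExactlyAt-tail exact)
  untouched : ∀ c₁ {v} → (st [ pick c₁ a b ≔ v ]) j ≡ unmarked
  untouched c₁ {v} = trans ([≔]-miss st v (InvolvedExactlyAt-outside exact c₁)) stj
survivors-exact-bound-unmarked {suc T} j ((a , b) ∷ τs) (inside ∷ S) distinct exact st doomed stj =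
  ≤-trans (scaled-≤ (survivors j ((a , b) ∷ τs) (inside ∷ S) st) 4
             (survivors-inside j a b τs S st (distinct Fin.zero) (proj₁ (exact Fin.zero) here) doomed
                (4 ^ ∣ S ∣) (4 ^ T) ((1 + ∣ S ∣) * 4 ^ T)
                (λ t → afterFirstMark _ (Doomed-transition doomed t)
                         (trans ([≔]-hit st j _)
                                (firstMark (subst (λ v → AvoidingTransition j j v _) stj t))))
                (λ o≢j t → IH _ (Doomed-transition doomed t) (trans ([≔]-miss st _ (o≢j ∘ sym)) stj))))
          (≤-reflexive (x∙yz≈y∙xz 4 (2 + ∣ S ∣) (4 ^ T)))
  where
  IH : ∀ st → Doomed j st → st j ≡ unmarked → survivors j τs S st * 4 ^ ∣ S ∣ ≤ (1 + ∣ S ∣) * 4 ^ T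
  IH = survivors-exact-bound-unmarked j τs S (distinct ∘ Fin.suc) (InvolvedExactlyAt-tail exact)
  afterFirstMark : ∀ st → Doomed j st → st j ≡ markedOnce false → survivors j τs S st * 4 ^ ∣ S ∣ ≤ 4 ^ T
  afterFirstMark = survivors-exact-bound-markedOnce j τs S (distinct ∘ Fin.suc) (InvolvedExactlyAt-tail exact)
  firstMark : ∀ {v′} → AvoidingTransition j j unmarked v′ → v′ ≡ markedOnce false
  firstMark (first own)         = refl
  firstMark (first (other j≢j)) = ⊥-elim (j≢j refl)

lemma6p2 : ∀ (T : ℕ) (τ : Vec TwoWay T)
           → (∀ t → proj₁ (lookup τ t) ≢ proj₂ (lookup τ t))
           → ∀ (j : ℕ) (S : Subset T)
           → ((∀ t → t ∈ S → Involves j (lookup τ t))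
               → countNone τ j S * 2 ^ ∣ S ∣ ≤ 4 ^ T)
             × ((∀ t → (t ∈ S → Involves j (lookup τ t)) × (Involves j (lookup τ t) → t ∈ S))
               → countNone τ j S * 2 ^ (2 * ∣ S ∣) ≤ (1 + ∣ S ∣) * 4 ^ T)
lemma6p2 T τ distinct j S =
  (λ involved → subst (λ n → n * 2 ^ ∣ S ∣ ≤ 4 ^ T) (sym counts)
                  (survivors-involved-bound j τ S distinct involved initial initial-doomed)) ,
  (λ exact → subst₂ (λ n k → n * k ≤ (1 + ∣ S ∣) * 4 ^ T) (sym counts) (^-*-assoc 2 2 ∣ S ∣)
               (survivors-exact-bound-unmarked j τ S distinct exact initial initial-doomed refl))
  where
  initial : State⁺
  initial _ = unmarked
  initial-doomed : Doomed j initial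
  initial-doomed _ ()
  counts : countNone τ j S ≡ survivors j τ S initial
  counts = trans (length-filterᵇ _ (allCoins T)) (countFrom-survivors j τ S (λ _ → unmarked) distinct)
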